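{- For every $n$, $T(n,\mathcal{F}(4),2)=\max\{T(n,\mathcal{F}(4),1),\ m(n,4,2\circ K_4)+2,\ m(n,4,K_5-e)+2\}$.
   Context: A 4-graph is a pair $(X,\mathcal{A})$ with $X$ a finite vertex set and $\mathcal{A}$ a set of 4-subsets of $X$ (edges); its order is $|X|$. $\mathcal{F}(4)=\{\Lambda(4,2),\Lambda(4,3)\}$, where $\Lambda(4,t)$ is the 4-graph with two edges meeting in exactly $t$ points. $T(n,\mathcal{F}(4),1)$ is the maximum number of edges of a 4-graph of order $n$ in which no two distinct edges meet in at least two points; $T(n,\mathcal{F}(4),2)$ is the maximum number of edges of a 4-graph of order $n$ in which at most one pair of distinct edges meets in at least two points. A 2-$(n,4,1)$ packing is a 4-graph of order $n$ in which every 2-subset lies in at most one edge (block); its leave is the graph whose edges are the 2-subsets contained in no block. $m(n,4,G)$ is the maximum number of blocks of a 2-$(n,4,1)$ packing whose leave contains a subgraph isomorphic to the graph $G$. $K_5-e$ is $K_5$ minus one edge; $2\circ K_4$ is two copies of $K_4$ sharing exactly one edge. -}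

module Defs where

open import Data.Nat using (ℕ; zero; suc; _+_; _≤_; _≤?_; _⊔_)
open import Data.Fin using (Fin; zero; suc)
open import Data.Fin.Subset using (Subset; _∈_; _∩_; ∣_∣)
open import Data.Fin.Subset.Properties using (_∈?_)
open import Data.List using (List; []; _∷_; length; filter)
open import Data.List.Membership.Propositional as LM using ()
open import Data.List.Relation.Unary.All using (All)
open import Data.List.Relation.Unary.Unique.Propositional using (Unique)
open import Data.Maybe using (Maybe; just; nothing)
open import Data.Product using (Σ; ∃; _×_; _,_)
open import Relation.Nullary using (¬_)
open import Relation.Nullary.Decidable using (_×-dec_)
open import Relation.Binary.PropositionalEquality using (_≡_; _≢_)
open import Function.Definitions using (Injective)

record FourGraph (n : ℕ) : Set where
  constructor mk4G
  field
    edges    : List (Subset n)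
    distinct : Unique edges
    size4    : All (λ e → ∣ e ∣ ≡ 4) edges

open FourGraph public

badPairs : ∀ {n} → List (Subset n) → ℕ
badPairs []       = 0
badPairs (e ∷ es) = length (filter (λ f → 2 ≤? ∣ e ∩ f ∣) es) + badPairs es

-- G is F(4)-free "up to λ": at most λ - 1 pairs of distinct edges meet
-- in at least two points.  (λ = 1: no such pair; λ = 2: at most one.)
AdmissibleF4 : ∀ {n} → ℕ → FourGraph n → Set
AdmissibleF4 λ′ G = suc (badPairs (edges G)) ≤ λ′

IsMaximum : (ℕ → Set) → ℕ → Set
IsMaximum P k = P k × (∀ j → P j → j ≤ k)

IsT : ℕ → ℕ → ℕ → Set
IsT n λ′ = IsMaximum (λ e → Σ (FourGraph n) λ G → AdmissibleF4 λ′ G × length (edges G) ≡ e)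

blocksThrough : ∀ {n} → Fin n → Fin n → List (Subset n) → List (Subset n)
blocksThrough x y = filter (λ b → (x ∈? b) ×-dec (y ∈? b))

IsPacking : ∀ {n} → FourGraph n → Set
IsPacking {n} G = ∀ (x y : Fin n) → x ≢ y → length (blocksThrough x y (edges G)) ≤ 1

InLeave : ∀ {n} → FourGraph n → Fin n → Fin n → Set
InLeave G x y = (x ≢ y) × All (λ b → ¬ (x ∈ b × y ∈ b)) (edges G)

record SimpleGraph : Set where
  constructor mkGraph
  field
    verts : ℕ
    gedges : List (Fin verts × Fin verts)

open SimpleGraph public

LeaveContains : ∀ {n} → FourGraph n → SimpleGraph → Set
LeaveContains {n} G H =
  Σ (Fin (verts H) → Fin n) λ φ → Injective _≡_ _≡_ φ ×
    All (λ { (a , b) → InLeave G (φ a) (φ b) }) (gedges H)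

MSet : ℕ → SimpleGraph → ℕ → Set
MSet n H b = Σ (FourGraph n) λ G → IsPacking G × LeaveContains G H × length (edges G) ≡ b

-- IsMOpt n H (just m) : m = m(n,4,H);
-- IsMOpt n H nothing  : no such packing exists (m(n,4,H) undefined, read as -∞)
data IsMOpt (n : ℕ) (H : SimpleGraph) : Maybe ℕ → Set where
  undefined : (∀ b → ¬ MSet n H b) → IsMOpt n H nothing
  defined   : ∀ {m} → IsMaximum (MSet n H) m → IsMOpt n H (just m)

-- m + 2, with the undefined value (-∞) contributing nothing to the max
-- (the other argument of the max, T(n,F(4),1), is always ≥ 0)
plus2 : Maybe ℕ → ℕ
plus2 nothing  = 0
plus2 (just m) = m + 2

v0 v1 v2 v3 v4 v5 : Fin 6
v0 = zero
v1 = suc zero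
v2 = suc (suc zero)
v3 = suc (suc (suc zero))
v4 = suc (suc (suc (suc zero)))
v5 = suc (suc (suc (suc (suc zero))))

K5-e : SimpleGraph
K5-e = mkGraph 5
  ( (f0 , f1) ∷ (f0 , f2) ∷ (f0 , f3) ∷ (f0 , f4)
  ∷ (f1 , f2) ∷ (f1 , f3) ∷ (f1 , f4)
  ∷ (f2 , f3) ∷ (f2 , f4) ∷ [] )
  where
  f0 f1 f2 f3 f4 : Fin 5
  f0 = zero
  f1 = suc zero
  f2 = suc (suc zero)
  f3 = suc (suc (suc zero))
  f4 = suc (suc (suc (suc zero)))

TwoK4 : SimpleGraph
TwoK4 = mkGraph 6
  ( (v0 , v1) ∷ (v0 , v2) ∷ (v0 , v3) ∷ (v1 , v2) ∷ (v1 , v3) ∷ (v2 , v3)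
  ∷ (v2 , v4) ∷ (v2 , v5) ∷ (v3 , v4) ∷ (v3 , v5) ∷ (v4 , v5) ∷ [] )

module Submission where

-- Call two edges overlapping when they share at least two points.  A
-- 4-graph is a 2-(n,4,1) packing exactly when no two of its edges
-- overlap, and badPairs counts the overlapping pairs.
--
-- A 4-graph with no overlapping pair is counted by
-- T(n,F(4),1).  If it has exactly one, say {e,f}, the remaining edges
-- form a packing with which e and f are compatible, so every pair inside
-- e or inside f lies in its leave.  Since |e| = |f| = 4 and e ≠ f, the
-- sets share 2 or 3 points: the leave then contains 2∘K4 (two 4-cliques
-- sharing an edge) or K5-e (two 4-cliques sharing a triangle).
--
-- Conversely, adding to a packing the images of two
-- distinct 4-cliques of its leave creates at most one overlapping pair.
-- Both 2∘K4 and K5-e contain two such cliques, giving m + 2 ≤ T(n,F(4),2).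
--
-- Both directions rest on one description of the two graphs: each is the
-- union of two distinct 4-cliques (TwoCliques).

open import Defs
open import Data.Nat using (ℕ; zero; suc; pred; _+_; _≤_; _≤?_; _⊔_; z≤n; s≤s)
open import Data.Nat.Properties
  using (≤-refl; ≤-trans; ≤-reflexive; ≤-pred; n≤1+n; ≤-antisym; <⇒≢; <⇒≱; +-comm; +-identityʳ;
         +-suc; +-cancelˡ-≡; +-cancelʳ-≡; +-monoˡ-≤; m+n≡0⇒m≡0; m+n≡0⇒n≡0; n≤1⇒n≡0∨n≡1; ⊔-lub;
         m≤n⇒m≤n⊔o; m≤n⇒m≤o⊔n; module ≤-Reasoning)
open import Data.Bool using (true; false)
open import Data.Fin using (Fin; zero; suc; _≟_; #_)
open import Data.Fin.Properties using (suc-injective)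
open import Data.Fin.Subset using (Subset; _∈_; _∉_; _∩_; _∪_; ∁; ∣_∣; ⁅_⁆; ⊥)
open import Data.Fin.Subset.Properties
  using (_∈?_; x∈p∩q⁺; x∈p∩q⁻; x∈p∪q⁺; x∈p∪q⁻; x∈⁅x⁆; x∈⁅y⁆⇒x≡y; ∉⊥; x∈∁p⇒x∉p;
         ∪-identityˡ; ∩-comm; ∩-idem; ∣⊥∣≡0; p⊆q⇒∣p∣≤∣q∣)
open import Data.List using (List; []; _∷_; length; filter)
open import Data.List.Properties using (filter-accept; filter-reject; filter-none; filter-some)
open import Data.List.Membership.Propositional using (lose) renaming (_∈_ to _∈ₗ_)
import Data.List.Membership.DecPropositional as DecMembership
open import Data.List.Relation.Unary.All as All using (All; []; _∷_)
open import Data.List.Relation.Unary.All.Properties using (¬Any⇒All¬)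
open import Data.List.Relation.Unary.AllPairs as AllPairs using (AllPairs; []; _∷_)
open import Data.List.Relation.Unary.Unique.Propositional using () renaming (Unique to Uniqueₗ)
open import Data.List.Relation.Binary.Permutation.Propositional
  using (_↭_; prep; swap; ↭-refl; ↭-sym; ↭-trans; ↭⇒↭ₛ)
open import Data.List.Relation.Binary.Permutation.Propositional.Properties
  using (All-resp-↭; ↭-length; shift)
import Data.List.Relation.Binary.Permutation.Setoid.Properties as SetoidPermutation
open import Data.Vec as Vec using (Vec; []; _∷_; here; there)
open import Data.Vec.Membership.Propositional using () renaming (_∈_ to _∈ᵥ_)
open import Data.Vec.Membership.Propositional.Properties using (∈-map⁺)
import Data.Vec.Membership.DecPropositional as VecDecMembership
open import Data.Vec.Relation.Unary.All as VecAll using ([]; _∷_)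
open import Data.Vec.Relation.Unary.All.Properties as VecAllProperties using ()
open import Data.Vec.Relation.Unary.Any as VecAny using (here; there)
open import Data.Vec.Relation.Unary.Any.Properties as VecAnyProperties using ()
open import Data.Vec.Relation.Unary.AllPairs using (allPairs?; []; _∷_)
open import Data.Vec.Relation.Unary.AllPairs.Properties using () renaming (++⁺ to unique-++⁺)
open import Data.Vec.Relation.Unary.Unique.Propositional using (Unique)
open import Data.Vec.Relation.Unary.Unique.Propositional.Properties
  using (lookup-injective) renaming (map⁺ to unique-map⁺)
open import Data.Maybe using (Maybe)
open import Data.Product using (Σ; _×_; _,_; proj₁; proj₂)
open import Data.Product.Properties using (≡-dec)
open import Data.Sum as Sum using (_⊎_; inj₁; inj₂)
open import Data.Empty using (⊥-elim)
open import Function using (_∘_)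
open import Function.Definitions using (Injective)
open import Level using (0ℓ)
open import Relation.Nullary using (¬_; Dec; yes; no; ¬?)
open import Relation.Nullary.Decidable using (_×-dec_; _⊎-dec_; from-yes)
open import Relation.Unary using (Pred; Decidable)
open import Relation.Binary.PropositionalEquality
  using (_≡_; _≢_; refl; sym; trans; cong; cong₂; subst; ≢-sym; resp₂; setoid; module ≡-Reasoning)

private variable
  n k l : ℕ

setOf : Vec (Fin n) k → Subset n
setOf []       = ⊥
setOf (x ∷ xs) = ⁅ x ⁆ ∪ setOf xs

∈-setOf⁺ : {x : Fin n} {xs : Vec (Fin n) k} → x ∈ᵥ xs → x ∈ setOf xs
∈-setOf⁺ {xs = y ∷ _} (here refl) = x∈p∪q⁺ (inj₁ (x∈⁅x⁆ y))
∈-setOf⁺ (there x∈ys)             = x∈p∪q⁺ (inj₂ (∈-setOf⁺ x∈ys))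

∈-setOf⁻ : {x : Fin n} (xs : Vec (Fin n) k) → x ∈ setOf xs → x ∈ᵥ xs
∈-setOf⁻ []       x∈⊥ = ⊥-elim (∉⊥ x∈⊥)
∈-setOf⁻ (y ∷ ys) x∈  with x∈p∪q⁻ ⁅ y ⁆ (setOf ys) x∈
... | inj₁ x∈⁅y⁆ = here (x∈⁅y⁆⇒x≡y y x∈⁅y⁆)
... | inj₂ x∈ys  = there (∈-setOf⁻ ys x∈ys)

∣⁅x⁆∪p∣ : (x : Fin n) (p : Subset n) → x ∉ p → ∣ ⁅ x ⁆ ∪ p ∣ ≡ suc ∣ p ∣
∣⁅x⁆∪p∣ zero    (true  ∷ p) x∉p = ⊥-elim (x∉p here)
∣⁅x⁆∪p∣ zero    (false ∷ p) _   = cong (suc ∘ ∣_∣) (∪-identityˡ p)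
∣⁅x⁆∪p∣ (suc x) (true  ∷ p) x∉p = cong suc (∣⁅x⁆∪p∣ x p (x∉p ∘ there))
∣⁅x⁆∪p∣ (suc x) (false ∷ p) x∉p = ∣⁅x⁆∪p∣ x p (x∉p ∘ there)

∣setOf∣ : {xs : Vec (Fin n) k} → Unique xs → ∣ setOf xs ∣ ≡ k
∣setOf∣ {n} {xs = []}     []          = ∣⊥∣≡0 n
∣setOf∣ {xs = x ∷ xs} (x∉xs ∷ u) =
  trans (∣⁅x⁆∪p∣ x (setOf xs) (λ x∈ → VecAll.lookup x∉xs (∈-setOf⁻ xs x∈) refl)) (cong suc (∣setOf∣ u))

distinct⇒≤∣∣ : {xs : Vec (Fin n) k} {p : Subset n} → Unique xs → VecAll.All (_∈ p) xs → k ≤ ∣ p ∣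
distinct⇒≤∣∣ {xs = xs} u xs⊆p =
  subst (_≤ _) (∣setOf∣ u) (p⊆q⇒∣p∣≤∣q∣ (λ x∈ → VecAll.lookup xs⊆p (∈-setOf⁻ xs x∈)))

Points : ℕ → Subset n → Set
Points {n} k p = Σ (Vec (Fin n) k) λ xs → Unique xs × VecAll.All (_∈ p) xs

distinctMembers : ∀ k (p : Subset n) → k ≤ ∣ p ∣ → Points k p
distinctMembers zero    p           _        = [] , [] , []
distinctMembers (suc k) (true ∷ p)  (s≤s k≤) with distinctMembers k p k≤
... | xs , u , xs⊆p =
  zero ∷ Vec.map suc xs ,
  VecAllProperties.map⁺ (VecAll.universal (λ _ ()) xs) ∷ unique-map⁺ suc-injective u ,
  here ∷ VecAllProperties.map⁺ (VecAll.map there xs⊆p)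
distinctMembers (suc k) (false ∷ p) k≤       with distinctMembers (suc k) p k≤
... | xs , u , xs⊆p =
  Vec.map suc xs , unique-map⁺ suc-injective u , VecAllProperties.map⁺ (VecAll.map there xs⊆p)

∣p∣≡∣p∩q∣+∣p∩∁q∣ : (p q : Subset n) → ∣ p ∣ ≡ ∣ p ∩ q ∣ + ∣ p ∩ ∁ q ∣
∣p∣≡∣p∩q∣+∣p∩∁q∣ []          []          = refl
∣p∣≡∣p∩q∣+∣p∩∁q∣ (true  ∷ p) (true  ∷ q) = cong suc (∣p∣≡∣p∩q∣+∣p∩∁q∣ p q)
∣p∣≡∣p∩q∣+∣p∩∁q∣ (true  ∷ p) (false ∷ q) = trans (cong suc (∣p∣≡∣p∩q∣+∣p∩∁q∣ p q)) (sym (+-suc _ _))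
∣p∣≡∣p∩q∣+∣p∩∁q∣ (false ∷ p) (_     ∷ q) = ∣p∣≡∣p∩q∣+∣p∩∁q∣ p q

∣p∩∁q∣≡∣q∩∁p∣ : (p q : Subset n) → ∣ p ∣ ≡ ∣ q ∣ → ∣ p ∩ ∁ q ∣ ≡ ∣ q ∩ ∁ p ∣
∣p∩∁q∣≡∣q∩∁p∣ p q ∣p∣≡∣q∣ = +-cancelˡ-≡ ∣ p ∩ q ∣ _ _ (begin
  ∣ p ∩ q ∣ + ∣ p ∩ ∁ q ∣ ≡⟨ sym (∣p∣≡∣p∩q∣+∣p∩∁q∣ p q) ⟩
  ∣ p ∣                   ≡⟨ ∣p∣≡∣q∣ ⟩
  ∣ q ∣                   ≡⟨ ∣p∣≡∣p∩q∣+∣p∩∁q∣ q p ⟩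
  ∣ q ∩ p ∣ + ∣ q ∩ ∁ p ∣ ≡⟨ cong (λ r → ∣ r ∣ + ∣ q ∩ ∁ p ∣) (∩-comm q p) ⟩
  ∣ p ∩ q ∣ + ∣ q ∩ ∁ p ∣ ∎)
  where open ≡-Reasoning

nothingOutside⇒≡ : (p q : Subset n) → ∣ p ∩ ∁ q ∣ ≡ 0 → ∣ q ∩ ∁ p ∣ ≡ 0 → p ≡ q
nothingOutside⇒≡ []          []          _  _  = refl
nothingOutside⇒≡ (true  ∷ p) (true  ∷ q) p₀ q₀ = cong (true ∷_) (nothingOutside⇒≡ p q p₀ q₀)
nothingOutside⇒≡ (true  ∷ p) (false ∷ q) ()  _
nothingOutside⇒≡ (false ∷ p) (true  ∷ q) _  ()
nothingOutside⇒≡ (false ∷ p) (false ∷ q) p₀ q₀ = cong (false ∷_) (nothingOutside⇒≡ p q p₀ q₀)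

∈∩ˡ : {x : Fin n} {p q : Subset n} → x ∈ p ∩ q → x ∈ p
∈∩ˡ {p = p} {q} = proj₁ ∘ x∈p∩q⁻ p q

∈∩ʳ : {x : Fin n} {p q : Subset n} → x ∈ p ∩ q → x ∈ q
∈∩ʳ {p = p} {q} = proj₂ ∘ x∈p∩q⁻ p q

∈∩∁ʳ : {x : Fin n} {p q : Subset n} → x ∈ p ∩ ∁ q → x ∉ q
∈∩∁ʳ {p = p} {q} = x∈∁p⇒x∉p ∘ proj₂ ∘ x∈p∩q⁻ p (∁ q)

apart : {x y : Fin n} {p : Subset n} → x ∈ p → y ∉ p → x ≢ y
apart x∈p y∉p refl = y∉p x∈p

Overlap : Subset n → Subset n → Set
Overlap e f = 2 ≤ ∣ e ∩ f ∣

overlap? : (e : Subset n) → Decidable (Overlap e)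
overlap? e f = 2 ≤? ∣ e ∩ f ∣

Compatible : Subset n → Subset n → Set
Compatible e f = ¬ Overlap e f

compatible-sym : (e f : Subset n) → Compatible e f → Compatible f e
compatible-sym e f c ov = c (subst (2 ≤_) (cong ∣_∣ (∩-comm f e)) ov)

selfOverlap : {e : Subset n} → 2 ≤ ∣ e ∣ → Overlap e e
selfOverlap {e = e} = subst (2 ≤_) (sym (cong ∣_∣ (∩-idem e)))

record CommonPair (e f : Subset n) : Set where
  constructor commonPair
  field
    x y : Fin n
    x≢y : x ≢ y
    x∈e : x ∈ e
    y∈e : y ∈ e
    x∈f : x ∈ f
    y∈f : y ∈ f

commonPair⇒overlap : {e f : Subset n} → CommonPair e f → Overlap e f
commonPair⇒overlap (commonPair x y x≢y x∈e y∈e x∈f y∈f) =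
  distinct⇒≤∣∣ ((x≢y ∷ []) ∷ [] ∷ []) (x∈p∩q⁺ (x∈e , x∈f) ∷ x∈p∩q⁺ (y∈e , y∈f) ∷ [])

overlap⇒commonPair : (e f : Subset n) → Overlap e f → CommonPair e f
overlap⇒commonPair e f ov with distinctMembers 2 (e ∩ f) ov
... | x ∷ y ∷ [] , (x≢y ∷ []) ∷ _ , x∈ ∷ y∈ ∷ [] =
  commonPair x y x≢y (∈∩ˡ x∈) (∈∩ˡ y∈) (∈∩ʳ x∈) (∈∩ʳ y∈)

noneSelected : {A : Set} {P : Pred A 0ℓ} (P? : Decidable P) (xs : List A) →
  length (filter P? xs) ≡ 0 → All (λ x → ¬ P x) xs
noneSelected P? xs none = ¬Any⇒All¬ xs (λ any → <⇒≢ (filter-some P? any) (sym none))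

filter-∷-≥ : {A : Set} {P : Pred A 0ℓ} (P? : Decidable P) (x : A) (xs : List A) →
  length (filter P? xs) ≤ length (filter P? (x ∷ xs))
filter-∷-≥ P? x xs with P? x
... | yes _ = n≤1+n _
... | no  _ = ≤-refl

filter-∷-≤ : {A : Set} {P : Pred A 0ℓ} (P? : Decidable P) (x : A) (xs : List A) →
  length (filter P? (x ∷ xs)) ≤ suc (length (filter P? xs))
filter-∷-≤ P? x xs with P? x
... | yes _ = ≤-refl
... | no  _ = n≤1+n _

noOverlap⇒pairwise : (es : List (Subset n)) → badPairs es ≡ 0 → AllPairs Compatible es
noOverlap⇒pairwise []       _    = []
noOverlap⇒pairwise (e ∷ es) none =
  noneSelected (overlap? e) es (m+n≡0⇒m≡0 _ none) ∷ noOverlap⇒pairwise es (m+n≡0⇒n≡0 _ none)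

pairwise⇒noOverlap : {es : List (Subset n)} → AllPairs Compatible es → badPairs es ≡ 0
pairwise⇒noOverlap []                    = refl
pairwise⇒noOverlap {es = e ∷ _} (c ∷ cs) =
  cong₂ _+_ (cong length (filter-none (overlap? e) c)) (pairwise⇒noOverlap cs)

onPair? : (x y : Fin n) → Decidable (λ b → x ∈ b × y ∈ b)
onPair? x y b = (x ∈? b) ×-dec (y ∈? b)

pairwise⇒packing : {bs : List (Subset n)} → AllPairs Compatible bs →
  ∀ x y → x ≢ y → length (blocksThrough x y bs) ≤ 1
pairwise⇒packing [] x y _ = z≤n
pairwise⇒packing {bs = e ∷ bs} (c ∷ cs) x y x≢y with onPair? x y e
... | yes (x∈e , y∈e) = ≤-reflexive (cong length (begin
  filter (onPair? x y) (e ∷ bs) ≡⟨ filter-accept (onPair? x y) (x∈e , y∈e) ⟩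
  e ∷ filter (onPair? x y) bs   ≡⟨ cong (e ∷_) (filter-none (onPair? x y) notBoth) ⟩
  e ∷ []                        ∎))
  where
  open ≡-Reasoning
  notBoth : All (λ b → ¬ (x ∈ b × y ∈ b)) bs
  notBoth = All.map (λ cb (x∈b , y∈b) → cb (commonPair⇒overlap (commonPair x y x≢y x∈e y∈e x∈b y∈b))) c
... | no ¬onPair = subst (_≤ 1) (cong length (sym (filter-reject (onPair? x y) ¬onPair)))
                    (pairwise⇒packing cs x y x≢y)

packing⇒pairwise : {bs : List (Subset n)} → (∀ x y → x ≢ y → length (blocksThrough x y bs) ≤ 1) →
  AllPairs Compatible bs
packing⇒pairwise {bs = []}     _  = []
packing⇒pairwise {bs = e ∷ bs} pk =
  All.tabulate compatibleWithHead ∷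
  packing⇒pairwise (λ x y x≢y → ≤-trans (filter-∷-≥ (onPair? x y) e bs) (pk x y x≢y))
  where
  compatibleWithHead : ∀ {f} → f ∈ₗ bs → Compatible e f
  compatibleWithHead f∈bs ov with overlap⇒commonPair e _ ov
  ... | commonPair x y x≢y x∈e y∈e x∈f y∈f =
    <⇒≱ (filter-some (onPair? x y) (lose f∈bs (x∈f , y∈f)))
        (≤-pred (subst (_≤ 1) (cong length (filter-accept (onPair? x y) (x∈e , y∈e))) (pk x y x≢y)))

singleSelected : {A : Set} {P : Pred A 0ℓ} (P? : Decidable P) (xs : List A) →
  length (filter P? xs) ≡ 1 →
  Σ A λ x → Σ (List A) λ ys → P x × All (λ y → ¬ P y) ys × xs ↭ x ∷ ys
singleSelected P? (x ∷ xs) one with P? x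
... | yes px = x , xs , px , noneSelected P? xs (cong pred one) , ↭-refl
... | no ¬px with singleSelected P? xs one
...   | y , ys , py , none , xs↭ = y , x ∷ ys , py , ¬px ∷ none , ↭-trans (prep x xs↭) (swap x y ↭-refl)

sum≡1 : ∀ a b → a + b ≡ 1 → (a ≡ 0 × b ≡ 1) ⊎ (a ≡ 1 × b ≡ 0)
sum≡1 zero          b    ab≡1 = inj₁ (refl , ab≡1)
sum≡1 (suc zero)    zero _    = inj₂ (refl , refl)

pairwise-resp-↭ : {xs ys : List (Subset n)} → xs ↭ ys → AllPairs Compatible xs → AllPairs Compatible ys
pairwise-resp-↭ {n} xs↭ys =
  SetoidPermutation.AllPairs-resp-↭ (setoid (Subset n))
    (λ {e} {f} → compatible-sym e f) (resp₂ Compatible) (↭⇒↭ₛ xs↭ys)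

record OverlapSplit (es : List (Subset n)) : Set where
  constructor overlapSplit
  field
    e f         : Subset n
    rest        : List (Subset n)
    arrangement : es ↭ e ∷ f ∷ rest
    overlapping : Overlap e f
    compatibleˡ : All (Compatible e) rest
    compatibleʳ : All (Compatible f) rest
    pairwise    : AllPairs Compatible rest

-- A list with exactly one overlapping pair splits as above: either the
-- head is compatible with everything and the pair lies in the tail, or the
-- head overlaps exactly one later entry and the tail is pairwise compatible.
splitOverlap : (es : List (Subset n)) → badPairs es ≡ 1 → OverlapSplit es
splitOverlap (x ∷ es) one with sum≡1 (length (filter (overlap? x) es)) (badPairs es) one
... | inj₁ (xCompatible , one′) with splitOverlap es one′
...   | overlapSplit e f rest es↭ ov ce cf cs
        with All-resp-↭ es↭ (noneSelected (overlap? x) es xCompatible)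
...     | x∼e ∷ x∼f ∷ x∼rest =
  overlapSplit e f (x ∷ rest) (↭-trans (prep x es↭) (↭-sym (shift x (e ∷ f ∷ []) rest))) ov
    (compatible-sym x e x∼e ∷ ce) (compatible-sym x f x∼f ∷ cf) (x∼rest ∷ cs)
splitOverlap (x ∷ es) one | inj₂ (xOverlapsOnce , none) with singleSelected (overlap? x) es xOverlapsOnce
... | f , rest , ov , cx , es↭ with pairwise-resp-↭ es↭ (noOverlap⇒pairwise es none)
...   | cf ∷ cs = overlapSplit x f rest (prep x es↭) ov cx cf cs

Adjacent : (H : SimpleGraph) → Fin (verts H) → Fin (verts H) → Set
Adjacent H i j = (i , j) ∈ₗ gedges H ⊎ (j , i) ∈ₗ gedges H

IsClique : (H : SimpleGraph) → Vec (Fin (verts H)) k → Set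
IsClique H vs = VecAll.All (λ i → VecAll.All (λ j → i ≡ j ⊎ Adjacent H i j) vs) vs

Within : {A : Set} → Vec A k → A × A → Set
Within vs ij = proj₁ ij ∈ᵥ vs × proj₂ ij ∈ᵥ vs

record TwoCliques (H : SimpleGraph) : Set where
  field
    first second    : Vec (Fin (verts H)) 4
    first-distinct  : Unique first
    second-distinct : Unique second
    first-clique    : IsClique H first
    second-clique   : IsClique H second
    witness         : Fin (verts H)
    witness∈first   : witness ∈ᵥ first
    witness∉second  : VecAll.All (witness ≢_) second
    loopless        : All (λ ij → proj₁ ij ≢ proj₂ ij) (gedges H)
    covered         : All (λ ij → Within first ij ⊎ Within second ij) (gedges H)

unique? : ∀ {m} (vs : Vec (Fin m) k) → Dec (Unique vs)
unique? = allPairs? (λ i j → ¬? (i ≟ j))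

isClique? : (H : SimpleGraph) (vs : Vec (Fin (verts H)) k) → Dec (IsClique H vs)
isClique? H vs = VecAll.all? (λ i → VecAll.all? (λ j → (i ≟ j) ⊎-dec adjacent? i j) vs) vs
  where
  open DecMembership (≡-dec _≟_ _≟_) using () renaming (_∈?_ to _∈ₗ?_)
  adjacent? : ∀ i j → Dec (Adjacent H i j)
  adjacent? i j = ((i , j) ∈ₗ? gedges H) ⊎-dec ((j , i) ∈ₗ? gedges H)

loopless? : (H : SimpleGraph) → Dec (All (λ ij → proj₁ ij ≢ proj₂ ij) (gedges H))
loopless? H = All.all? (λ ij → ¬? (proj₁ ij ≟ proj₂ ij)) (gedges H)

covered? : (H : SimpleGraph) (vs ws : Vec (Fin (verts H)) k) →
  Dec (All (λ ij → Within vs ij ⊎ Within ws ij) (gedges H))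
covered? H vs ws = All.all? (λ ij → within? vs ij ⊎-dec within? ws ij) (gedges H)
  where
  open VecDecMembership (_≟_ {verts H}) using () renaming (_∈?_ to _∈ᵥ?_)
  within? : (us : Vec (Fin (verts H)) k) (ij : Fin (verts H) × Fin (verts H)) → Dec (Within us ij)
  within? us ij = (proj₁ ij ∈ᵥ? us) ×-dec (proj₂ ij ∈ᵥ? us)

twoK4-cliques : TwoCliques TwoK4
twoK4-cliques = record
  { first           = first
  ; second          = second
  ; first-distinct  = from-yes (unique? first)
  ; second-distinct = from-yes (unique? second)
  ; first-clique    = from-yes (isClique? TwoK4 first)
  ; second-clique   = from-yes (isClique? TwoK4 second)
  ; witness         = # 0
  ; witness∈first   = here refl
  ; witness∉second  = from-yes (VecAll.all? (λ j → ¬? (# 0 ≟ j)) second)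
  ; loopless        = from-yes (loopless? TwoK4)
  ; covered         = from-yes (covered? TwoK4 first second)
  }
  where
  first second : Vec (Fin 6) 4
  first  = # 0 ∷ # 1 ∷ # 2 ∷ # 3 ∷ []
  second = # 2 ∷ # 3 ∷ # 4 ∷ # 5 ∷ []

K5-e-cliques : TwoCliques K5-e
K5-e-cliques = record
  { first           = first
  ; second          = second
  ; first-distinct  = from-yes (unique? first)
  ; second-distinct = from-yes (unique? second)
  ; first-clique    = from-yes (isClique? K5-e first)
  ; second-clique   = from-yes (isClique? K5-e second)
  ; witness         = # 3
  ; witness∈first   = there (there (there (here refl)))
  ; witness∉second  = from-yes (VecAll.all? (λ j → ¬? (# 3 ≟ j)) second)
  ; loopless        = from-yes (loopless? K5-e)
  ; covered         = from-yes (covered? K5-e first second)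
  }
  where
  first second : Vec (Fin 5) 4
  first  = # 0 ∷ # 1 ∷ # 2 ∷ # 3 ∷ []
  second = # 0 ∷ # 1 ∷ # 2 ∷ # 4 ∷ []

pairInLeave : (G : FourGraph n) {p : Subset n} → All (Compatible p) (edges G) →
  {x y : Fin n} → x ≢ y → x ∈ p → y ∈ p → InLeave G x y
pairInLeave G cp x≢y x∈p y∈p =
  x≢y , All.map (λ cb (x∈b , y∈b) → cb (commonPair⇒overlap (commonPair _ _ x≢y x∈p y∈p x∈b y∈b))) cp

apartAll : {xs : Vec (Fin n) k} {ys : Vec (Fin n) l} {p : Subset n} →
  VecAll.All (_∈ p) xs → VecAll.All (_∉ p) ys → VecAll.All (λ x → VecAll.All (x ≢_) ys) xs
apartAll xs∈p ys∉p = VecAll.map (λ x∈p → VecAll.map (apart x∈p) ys∉p) xs∈p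

apartAll′ : {xs : Vec (Fin n) k} {ys : Vec (Fin n) l} {p : Subset n} →
  VecAll.All (_∉ p) xs → VecAll.All (_∈ p) ys → VecAll.All (λ x → VecAll.All (x ≢_) ys) xs
apartAll′ xs∉p ys∈p = VecAll.map (λ x∉p → VecAll.map (λ y∈p → ≢-sym (apart y∈p x∉p)) ys∈p) xs∉p

module _ (G : FourGraph n) {e f : Subset n}
         (ce : All (Compatible e) (edges G)) (cf : All (Compatible f) (edges G)) where

  -- Let H be the union of two 4-cliques.  Placing its vertices at distinct
  -- points, the first clique inside e and the second inside f, embeds H
  -- into the leave, since each edge of H lies inside e or inside f.
  placeInLeave : {H : SimpleGraph} (C : TwoCliques H) (vs : Vec (Fin n) (verts H)) → Unique vs →
    VecAll.All (_∈ e) (Vec.map (Vec.lookup vs) (TwoCliques.first C)) →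
    VecAll.All (_∈ f) (Vec.map (Vec.lookup vs) (TwoCliques.second C)) →
    LeaveContains G H
  placeInLeave {H} C vs distinctPoints first⊆e second⊆f =
    φ , injective ,
    All.map (λ { {i , j} (i≢j , within) → edgeInLeave i≢j within }) (All.zip (loopless , covered))
    where
    open TwoCliques C
    φ : Fin (verts H) → Fin n
    φ = Vec.lookup vs
    injective : Injective _≡_ _≡_ φ
    injective {i} {j} = lookup-injective distinctPoints i j
    edgeInLeave : ∀ {i j} → i ≢ j → Within first (i , j) ⊎ Within second (i , j) → InLeave G (φ i) (φ j)
    edgeInLeave i≢j (inj₁ (i∈ , j∈)) = pairInLeave G ce (i≢j ∘ injective)
      (VecAll.lookup first⊆e (∈-map⁺ φ i∈)) (VecAll.lookup first⊆e (∈-map⁺ φ j∈))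
    edgeInLeave i≢j (inj₂ (i∈ , j∈)) = pairInLeave G cf (i≢j ∘ injective)
      (VecAll.lookup second⊆f (∈-map⁺ φ i∈)) (VecAll.lookup second⊆f (∈-map⁺ φ j∈))

  -- If e and f share two points c, d and each has two further points
  -- a, b resp. g, h, then placing 2∘K4 at a, b, c, d, g, h embeds it into
  -- the leave; the points are distinct as e ∖ f, e ∩ f and f ∖ e are disjoint.
  leave⊇TwoK4 : Points 2 (e ∩ ∁ f) → Points 2 (e ∩ f) → Points 2 (f ∩ ∁ e) → LeaveContains G TwoK4
  leave⊇TwoK4 (a ∷ b ∷ [] , ab-distinct , a∈ ∷ b∈ ∷ [])
              (c ∷ d ∷ [] , cd-distinct , c∈ ∷ d∈ ∷ [])
              (g ∷ h ∷ [] , gh-distinct , g∈ ∷ h∈ ∷ []) =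
    placeInLeave twoK4-cliques (a ∷ b ∷ c ∷ d ∷ g ∷ h ∷ []) distinctPoints abcd⊆e cdgh⊆f
    where
    abcd⊆e : VecAll.All (_∈ e) (a ∷ b ∷ c ∷ d ∷ [])
    abcd⊆e = ∈∩ˡ a∈ ∷ ∈∩ˡ b∈ ∷ ∈∩ˡ c∈ ∷ ∈∩ˡ d∈ ∷ []
    cdgh⊆f : VecAll.All (_∈ f) (c ∷ d ∷ g ∷ h ∷ [])
    cdgh⊆f = ∈∩ʳ c∈ ∷ ∈∩ʳ d∈ ∷ ∈∩ˡ g∈ ∷ ∈∩ˡ h∈ ∷ []
    distinctPoints : Unique (a ∷ b ∷ c ∷ d ∷ g ∷ h ∷ [])
    distinctPoints =
      unique-++⁺ ab-distinct
        (unique-++⁺ cd-distinct gh-distinct (apartAll (∈∩ˡ c∈ ∷ ∈∩ˡ d∈ ∷ []) (∈∩∁ʳ g∈ ∷ ∈∩∁ʳ h∈ ∷ [])))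
        (apartAll′ (∈∩∁ʳ a∈ ∷ ∈∩∁ʳ b∈ ∷ []) cdgh⊆f)

  leave⊇K5-e : Points 3 (e ∩ f) → Points 1 (e ∩ ∁ f) → Points 1 (f ∩ ∁ e) → LeaveContains G K5-e
  leave⊇K5-e (a ∷ b ∷ c ∷ [] , abc-distinct , abc∈@(a∈ ∷ b∈ ∷ c∈ ∷ []))
             (d ∷ [] , _ , d∈ ∷ [])
             (g ∷ [] , _ , g∈ ∷ []) =
    placeInLeave K5-e-cliques (a ∷ b ∷ c ∷ d ∷ g ∷ []) distinctPoints
      (∈∩ˡ a∈ ∷ ∈∩ˡ b∈ ∷ ∈∩ˡ c∈ ∷ ∈∩ˡ d∈ ∷ []) (∈∩ʳ a∈ ∷ ∈∩ʳ b∈ ∷ ∈∩ʳ c∈ ∷ ∈∩ˡ g∈ ∷ [])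
    where
    -- a, b, c lie in e and f, while d lies outside f and g outside e
    distinctPoints : Unique (a ∷ b ∷ c ∷ d ∷ g ∷ [])
    distinctPoints =
      unique-++⁺ abc-distinct ((apart (∈∩ˡ d∈) (∈∩∁ʳ g∈) ∷ []) ∷ [] ∷ [])
        (VecAll.map (λ x∈ → apart (∈∩ʳ x∈) (∈∩∁ʳ d∈) ∷ apart (∈∩ˡ x∈) (∈∩∁ʳ g∈) ∷ []) abc∈)

  -- Two distinct overlapping 4-sets share two or three points, so the
  -- leave contains 2∘K4 or K5-e.
  leaveOfOverlap : ∣ e ∣ ≡ 4 → ∣ f ∣ ≡ 4 → Overlap e f → e ≢ f →
    LeaveContains G TwoK4 ⊎ LeaveContains G K5-e
  leaveOfOverlap e4 f4 ov e≢f = byPointsOutside ∣ e ∩ ∁ f ∣ refl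
    where
    sameOutside : ∣ f ∩ ∁ e ∣ ≡ ∣ e ∩ ∁ f ∣
    sameOutside = ∣p∩∁q∣≡∣q∩∁p∣ f e (trans f4 (sym e4))
    total : ∣ e ∩ f ∣ + ∣ e ∩ ∁ f ∣ ≡ 4
    total = trans (sym (∣p∣≡∣p∩q∣+∣p∩∁q∣ e f)) e4
    byPointsOutside : ∀ r → ∣ e ∩ ∁ f ∣ ≡ r → LeaveContains G TwoK4 ⊎ LeaveContains G K5-e
    byPointsOutside zero          r≡0 = ⊥-elim (e≢f (nothingOutside⇒≡ e f r≡0 (trans sameOutside r≡0)))
    byPointsOutside (suc zero)    r≡1 = inj₂ (leave⊇K5-e
      (distinctMembers 3 (e ∩ f) (≤-reflexive (sym common≡3)))
      (distinctMembers 1 (e ∩ ∁ f) (≤-reflexive (sym r≡1)))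
      (distinctMembers 1 (f ∩ ∁ e) (≤-reflexive (sym (trans sameOutside r≡1)))))
      where
      common≡3 : ∣ e ∩ f ∣ ≡ 3
      common≡3 = +-cancelʳ-≡ 1 ∣ e ∩ f ∣ 3 (trans (cong (∣ e ∩ f ∣ +_) (sym r≡1)) total)
    byPointsOutside (suc (suc r)) r≡ = inj₁ (leave⊇TwoK4
      (distinctMembers 2 (e ∩ ∁ f) (subst (2 ≤_) (sym r≡) (s≤s (s≤s z≤n))))
      (distinctMembers 2 (e ∩ f) ov)
      (distinctMembers 2 (f ∩ ∁ e) (subst (2 ≤_) (sym (trans sameOutside r≡)) (s≤s (s≤s z≤n)))))

Realisable : ℕ → ℕ → ℕ → Set
Realisable n λ′ e = Σ (FourGraph n) λ G → AdmissibleF4 λ′ G × length (edges G) ≡ e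

atMostOneOverlap : {e f : Subset n} {bs : List (Subset n)} →
  All (Compatible e) bs → All (Compatible f) bs → AllPairs Compatible bs → badPairs (e ∷ f ∷ bs) ≤ 1
atMostOneOverlap {e = e} {f} {bs} ce cf cs = begin
  length (filter (overlap? e) (f ∷ bs)) + badPairs (f ∷ bs)
    ≡⟨ cong (length (filter (overlap? e) (f ∷ bs)) +_) (pairwise⇒noOverlap {es = f ∷ bs} (cf ∷ cs)) ⟩
  length (filter (overlap? e) (f ∷ bs)) + 0
    ≡⟨ +-identityʳ _ ⟩
  length (filter (overlap? e) (f ∷ bs))
    ≤⟨ filter-∷-≤ (overlap? e) f bs ⟩
  suc (length (filter (overlap? e) bs))
    ≡⟨ cong (suc ∘ length) (filter-none (overlap? e) ce) ⟩
  1 ∎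
  where open ≤-Reasoning

extendPacking : (G : FourGraph n) → IsPacking G → {e f : Subset n} → ∣ e ∣ ≡ 4 → ∣ f ∣ ≡ 4 → e ≢ f →
  All (Compatible e) (edges G) → All (Compatible f) (edges G) → Realisable n 2 (length (edges G) + 2)
extendPacking {n} G pk {e} {f} e4 f4 e≢f ce cf =
  mk4G (e ∷ f ∷ edges G) ((e≢f ∷ new e4 ce) ∷ new f4 cf ∷ distinct G) (e4 ∷ f4 ∷ size4 G) ,
  s≤s (atMostOneOverlap {e = e} {f} ce cf (packing⇒pairwise pk)) ,
  +-comm 2 _
  where
  new : {p : Subset n} → ∣ p ∣ ≡ 4 → All (Compatible p) (edges G) → All (p ≢_) (edges G)
  new {p} p4 = All.map {P = Compatible p} (λ cb p≡b → cb (subst (Overlap p) p≡b p⋈p))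
    where
    p⋈p : Overlap p p
    p⋈p = selfOverlap {e = p} (subst (2 ≤_) (sym p4) (s≤s (s≤s z≤n)))

cliqueImageCompatible : (G : FourGraph n) (H : SimpleGraph) (emb : LeaveContains G H)
  {vs : Vec (Fin (verts H)) k} → IsClique H vs → All (Compatible (setOf (Vec.map (proj₁ emb) vs))) (edges G)
cliqueImageCompatible {n} G H (φ , _ , leaveEdges) {vs} clique = All.tabulate compatible
  where
  image : Subset n
  image = setOf (Vec.map φ vs)
  preimage : ∀ {x} → x ∈ image → VecAny.Any (λ i → x ≡ φ i) vs
  preimage x∈ = VecAnyProperties.map⁻ (∈-setOf⁻ (Vec.map φ vs) x∈)
  noBlockThrough : ∀ {i j b} → (i , j) ∈ₗ gedges H → b ∈ₗ edges G → ¬ (φ i ∈ b × φ j ∈ b)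
  noBlockThrough ij∈H = All.lookup (proj₂ (All.lookup leaveEdges ij∈H))
  compatible : ∀ {b} → b ∈ₗ edges G → Compatible image b
  compatible {b} b∈G ov with overlap⇒commonPair image _ ov
  ... | commonPair x y x≢y x∈ y∈ x∈b y∈b with VecAll.lookupAny clique (preimage x∈)
  ... | adjacentᵢ , x≡φi with VecAll.lookupAny adjacentᵢ (preimage y∈)
  ... | inj₁ i≡j         , y≡φj = x≢y (trans x≡φi (trans (cong φ i≡j) (sym y≡φj)))
  ... | inj₂ (inj₁ ij∈H) , y≡φj = noBlockThrough ij∈H b∈G (subst (_∈ b) x≡φi x∈b , subst (_∈ b) y≡φj y∈b)
  ... | inj₂ (inj₂ ji∈H) , y≡φj = noBlockThrough ji∈H b∈G (subst (_∈ b) y≡φj y∈b , subst (_∈ b) x≡φi x∈b)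

twoCliquesBound : {H : SimpleGraph} {b : ℕ} → TwoCliques H → MSet n H b → Realisable n 2 (b + 2)
twoCliquesBound {H = H} C (G , pk , emb@(φ , injective , _) , refl) =
  extendPacking G pk (size first-distinct) (size second-distinct) images-differ
    (cliqueImageCompatible G H emb first-clique) (cliqueImageCompatible G H emb second-clique)
  where
  open TwoCliques C
  size : {vs : Vec (Fin (verts H)) 4} → Unique vs → ∣ setOf (Vec.map φ vs) ∣ ≡ 4
  size u = ∣setOf∣ (unique-map⁺ injective u)
  -- the image of the witness lies in the first image but not the second
  images-differ : setOf (Vec.map φ first) ≢ setOf (Vec.map φ second)
  images-differ same
    with VecAll.lookupAny witness∉second (VecAnyProperties.map⁻ (∈-setOf⁻ (Vec.map φ second)
           (subst (φ witness ∈_) same (∈-setOf⁺ (∈-map⁺ φ witness∈first)))))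
  ... | witness≢j , φwitness≡φj = witness≢j (injective φwitness≡φj)

removeOverlap : (G : FourGraph n) → badPairs (edges G) ≡ 1 →
  Σ ℕ λ b → length (edges G) ≡ b + 2 × (MSet n TwoK4 b ⊎ MSet n K5-e b)
removeOverlap {n} G one =
  length rest ,
  trans (↭-length arrangement) (+-comm 2 _) ,
  Sum.map (λ L → G′ , packing , L , refl) (λ L → G′ , packing , L , refl)
    (leaveOfOverlap G′ compatibleˡ compatibleʳ e4 f4 overlapping e≢f)
  where
  open OverlapSplit (splitOverlap (edges G) one)
  open SetoidPermutation (setoid (Subset n)) using (Unique-resp-↭)
  rearranged : Uniqueₗ (e ∷ f ∷ rest)
  rearranged = Unique-resp-↭ (↭⇒↭ₛ arrangement) (distinct G)
  sizes : All (λ b → ∣ b ∣ ≡ 4) (e ∷ f ∷ rest)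
  sizes = All-resp-↭ arrangement (size4 G)
  e4 : ∣ e ∣ ≡ 4
  e4 = All.head sizes
  f4 : ∣ f ∣ ≡ 4
  f4 = All.head (All.tail sizes)
  e≢f : e ≢ f
  e≢f = All.head (AllPairs.head rearranged)
  G′ : FourGraph n
  G′ = mk4G rest (AllPairs.tail (AllPairs.tail rearranged)) (All.tail (All.tail sizes))
  packing : IsPacking G′
  packing = pairwise⇒packing pairwise

realisable-relax : ∀ {e} → Realisable n 1 e → Realisable n 2 e
realisable-relax (G , noOverlap , len) = G , ≤-trans noOverlap (n≤1+n 1) , len

cliques⇒lowerBound : {H : SimpleGraph} {m : Maybe ℕ} {t : ℕ} → TwoCliques H →
  (∀ j → Realisable n 2 j → j ≤ t) → IsMOpt n H m → plus2 m ≤ t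
cliques⇒lowerBound C maximal (undefined _)           = z≤n
cliques⇒lowerBound C maximal (defined (packing , _)) = maximal _ (twoCliquesBound C packing)

packing⇒upperBound : {H : SimpleGraph} {m : Maybe ℕ} {b : ℕ} → IsMOpt n H m → MSet n H b → b + 2 ≤ plus2 m
packing⇒upperBound (undefined none)        packing = ⊥-elim (none _ packing)
packing⇒upperBound (defined (_ , maximal)) packing = +-monoˡ-≤ 2 (maximal _ packing)

upperBound : {t1 : ℕ} {ma mb : Maybe ℕ} → (∀ j → Realisable n 1 j → j ≤ t1) →
  IsMOpt n TwoK4 ma → IsMOpt n K5-e mb →
  (G : FourGraph n) → AdmissibleF4 2 G → length (edges G) ≤ t1 ⊔ (plus2 ma ⊔ plus2 mb)
upperBound {t1 = t1} {ma} {mb} maximal₁ optA optB G atMostOne with n≤1⇒n≡0∨n≡1 (≤-pred atMostOne)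
... | inj₁ none = m≤n⇒m≤n⊔o _ (maximal₁ _ (G , ≤-reflexive (cong suc none) , refl))
... | inj₂ one with removeOverlap G one
...   | b , len , inj₁ twoK4 =
  m≤n⇒m≤o⊔n t1 (m≤n⇒m≤n⊔o (plus2 mb) (subst (_≤ plus2 ma) (sym len) (packing⇒upperBound optA twoK4)))
...   | b , len , inj₂ k5-e  =
  m≤n⇒m≤o⊔n t1 (m≤n⇒m≤o⊔n (plus2 ma) (subst (_≤ plus2 mb) (sym len) (packing⇒upperBound optB k5-e)))

corollary3p5 : ∀ (n t1 t2 : ℕ) (ma mb : Maybe ℕ) →
    IsT n 1 t1 → IsT n 2 t2 → IsMOpt n TwoK4 ma → IsMOpt n K5-e mb →
    t2 ≡ t1 ⊔ (plus2 ma ⊔ plus2 mb)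
corollary3p5 n t1 t2 ma mb (realisable₁ , maximal₁) ((G , atMostOne , G-size) , maximal₂) optA optB =
  ≤-antisym
    (subst (_≤ _) G-size (upperBound maximal₁ optA optB G atMostOne))
    (⊔-lub (maximal₂ t1 (realisable-relax realisable₁))
           (⊔-lub (cliques⇒lowerBound twoK4-cliques maximal₂ optA)
                  (cliques⇒lowerBound K5-e-cliques maximal₂ optB)))
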